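{- Let $\Gamma$ be a tree and let $F$ be an $A$-diagram over $\Gamma$. The forgetful functor $\mathsf{pr}_1:A/\mathcal{U}\to\mathcal{U}$ creates colimits over $\Gamma$, in the following sense. A cocone under $F$ in $A/\mathcal{U}$ is colimiting in $A/\mathcal{U}$ if and only if its image under the forgetful functor, which is a cocone under $\mathcal{F}(F)$ in $\mathcal{U}$, is colimiting in $\mathcal{U}$.
   Context: Work in homotopy type theory. Coslice categories. Fix a universe $\mathcal{U}$ and $A:\mathcal{U}$. The wild category $A/\mathcal{U}$ has objects $(X,f_X)$ with $f_X:A\to X$. Its morphisms are $$(X,f_X)\to_A(Y,f_Y):=\sum_{h:X\to Y}\prod_{a} h(f_X(a))=f_Y(a),$$ and composition is $(k,k_p)\circ(h,h_p)=(k\circ h,\ a\mapsto \mathsf{ap}_k(h_p(a))\cdot k_p(a))$. Graphs and diagrams. A graph $\Gamma$ consists of $\Gamma_0:\mathcal{U}$ and $\Gamma_1:\Gamma_0\to\Gamma_0\to\mathcal{U}$. An $A$-diagram $F$ over $\Gamma$ consists of objects $F_i$ and maps $F_{i,j,g}:F_i\to_A F_j$ for $g:\Gamma_1(i,j)$. Its underlying $\mathcal{U}$-diagram $\mathcal{F}(F)$ has types $\mathsf{pr}_1(F_i)$ and maps $\mathsf{pr}_1(F_{i,j,g})$. Cocones in $A/\mathcal{U}$. A cocone under $F$ on $T$ consists of maps $r_i:F_i\to_A T$ and identifications $r_j\circ F_{i,j,g}=r_i$. - Such a cocone $(C,r,K)$ is colimiting if for every $T$ the postcomposition map $(C\to_A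 T)\to\mathsf{Cocone}_F(T)$ is an equivalence. Postcomposition composes the legs with $f$, and whiskers and reassociates the triangles. - The forgetful image of $(C,r,K)$ is the cocone in $\mathcal{U}$ on $\mathsf{pr}_1(C)$ with legs $\mathsf{pr}_1(r_i)$ and homotopies $\mathsf{pr}_1(K_{i,j,g}):\mathsf{pr}_1(r_j)\circ\mathsf{pr}_1(F_{i,j,g})\sim\mathsf{pr}_1(r_i)$. Cocones in $\mathcal{U}$. A cocone in $\mathcal{U}$ under a $\mathcal{U}$-diagram $D$ on a type $C$ consists of maps $r_i:D_i\to C$ and homotopies $r_j\circ D_{i,j,g}\sim r_i$. It is colimiting if for every type $T$, postcomposition $(C\to T)\to\mathsf{Cocone}_D(T)$ is an equivalence. Trees. The geometric realization $|\Gamma|$ is the higher inductive type with a point $|i|$ for each $i:\Gamma_0$ and a path $|i|=|j|$ for each $g:\Gamma_1(i,j)$. $\Gamma$ is a tree if $|\Gamma|$ is contractible. -}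

{-# OPTIONS --without-K #-}
module Defs where

open import Level using (Level; _⊔_)
open import Data.Product using (Σ; Σ-syntax; _,_; proj₁; proj₂)
open import Relation.Binary.PropositionalEquality
  using (_≡_; refl; cong; trans; sym)

isContr : ∀ {ℓ} → Set ℓ → Set ℓ
isContr X = Σ[ c ∈ X ] (∀ x → c ≡ x)

fiber : ∀ {ℓ ℓ'} {X : Set ℓ} {Y : Set ℓ'} → (X → Y) → Y → Set (ℓ ⊔ ℓ')
fiber {X = X} f y = Σ[ x ∈ X ] (f x ≡ y)

isEquiv : ∀ {ℓ ℓ'} {X : Set ℓ} {Y : Set ℓ'} → (X → Y) → Set (ℓ ⊔ ℓ')
isEquiv {Y = Y} f = ∀ (y : Y) → isContr (fiber f y)

happly : ∀ {ℓ} {X : Set ℓ} {B : X → Set ℓ} {f g : (x : X) → B x}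
       → f ≡ g → ∀ x → f x ≡ g x
happly refl x = refl

FunExt : (ℓ : Level) → Set (Level.suc ℓ)
FunExt ℓ = ∀ {X : Set ℓ} {B : X → Set ℓ} {f g : (x : X) → B x}
         → isEquiv (happly {f = f} {g = g})

funext : ∀ {ℓ} → FunExt ℓ → {X : Set ℓ} {B : X → Set ℓ} {f g : (x : X) → B x}
       → (∀ x → f x ≡ g x) → f ≡ g
funext fe h = proj₁ (proj₁ (fe h))

record Graph (ℓ : Level) : Set (Level.suc ℓ) where
  field
    Γ₀ : Set ℓ
    Γ₁ : Γ₀ → Γ₀ → Set ℓ
open Graph public

-- Agda (non-cubical) has no higher inductive types,
-- so the realization is given as a type R with points |i| and paths |i| = |j|
-- satisfying the universal property of the HIT |Γ| (its recursion principle as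
-- an equivalence, for targets in the same universe).
record Realization {ℓ} (Γ : Graph ℓ) : Set (Level.suc ℓ) where
  field
    Carrier : Set ℓ
    pt      : Γ₀ Γ → Carrier
    edge    : ∀ i j → Γ₁ Γ i j → pt i ≡ pt j
    univ    : ∀ (T : Set ℓ) →
      isEquiv {X = Carrier → T}
              {Y = Σ[ p ∈ (Γ₀ Γ → T) ] (∀ i j → Γ₁ Γ i j → p i ≡ p j)}
              (λ f → (λ i → f (pt i)) , (λ i j g → cong f (edge i j g)))
open Realization public

isTree : ∀ {ℓ} (Γ : Graph ℓ) → Realization Γ → Set ℓ
isTree Γ R = isContr (Carrier R)

module Coslice {ℓ : Level} (A : Set ℓ) where

  Obj : Set (Level.suc ℓ)
  Obj = Σ[ X ∈ Set ℓ ] (A → X)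

  _⇒_ : Obj → Obj → Set ℓ
  (X , fX) ⇒ (Y , fY) = Σ[ h ∈ (X → Y) ] (∀ a → h (fX a) ≡ fY a)

  _∘A_ : ∀ {X Y Z} → Y ⇒ Z → X ⇒ Y → X ⇒ Z
  (k , kp) ∘A (h , hp) = (λ x → k (h x)) , (λ a → trans (cong k (hp a)) (kp a))

  private
    cong-∘ : ∀ {X Y Z : Set ℓ} (f : Y → Z) (g : X → Y) {x y : X} (p : x ≡ y)
           → cong (λ z → f (g z)) p ≡ cong f (cong g p)
    cong-∘ f g refl = refl
    cong-trans : ∀ {X Y : Set ℓ} (f : X → Y) {x y z : X} (p : x ≡ y) (q : y ≡ z)
               → cong f (trans p q) ≡ trans (cong f p) (cong f q)
    cong-trans f refl q = refl
    trans-assoc : ∀ {X : Set ℓ} {x y z w : X} (p : x ≡ y) (q : y ≡ z) (r : z ≡ w)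
                → trans (trans p q) r ≡ trans p (trans q r)
    trans-assoc refl q r = refl

  assoc-pt : ∀ {X Y Z W : Obj} (f : Z ⇒ W) (h : Y ⇒ Z) (k : X ⇒ Y) (a : A)
    → proj₂ ((f ∘A h) ∘A k) a ≡ proj₂ (f ∘A (h ∘A k)) a
  assoc-pt (f , fp) (h , hp) (k , kp) a =
    trans (cong (λ u → trans u (trans (cong f (hp a)) (fp a))) (cong-∘ f h (kp a)))
   (trans (sym (trans-assoc (cong f (cong h (kp a))) (cong f (hp a)) (fp a)))
          (cong (λ u → trans u (fp a)) (sym (cong-trans f (cong h (kp a)) (hp a)))))

  assoc : FunExt ℓ → ∀ {X Y Z W : Obj} (f : Z ⇒ W) (h : Y ⇒ Z) (k : X ⇒ Y)
        → (f ∘A h) ∘A k ≡ f ∘A (h ∘A k)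
  assoc fe f h k = cong (λ e → (proj₁ ((f ∘A h) ∘A k)) , e) (funext fe (assoc-pt f h k))

  record Diagram (Γ : Graph ℓ) : Set (Level.suc ℓ) where
    field
      ob  : Γ₀ Γ → Obj
      mor : ∀ i j → Γ₁ Γ i j → ob i ⇒ ob j
  open Diagram public

  Cocone : ∀ {Γ} → Diagram Γ → Obj → Set ℓ
  Cocone {Γ} F T = Σ[ r ∈ (∀ i → ob F i ⇒ T) ]
                   (∀ i j (g : Γ₁ Γ i j) → r j ∘A mor F i j g ≡ r i)

  postcomp : FunExt ℓ → ∀ {Γ} (F : Diagram Γ) {C T : Obj}
           → Cocone F C → C ⇒ T → Cocone F T
  postcomp fe F (r , K) f =
    (λ i → f ∘A r i) ,
    (λ i j g → trans (assoc fe f (r j) (mor F i j g)) (cong (f ∘A_) (K i j g)))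

  isColimiting : FunExt ℓ → ∀ {Γ} (F : Diagram Γ) {C : Obj} → Cocone F C → Set (Level.suc ℓ)
  isColimiting fe F {C} c = ∀ (T : Obj) → isEquiv (postcomp fe F {C} {T} c)

record DiagramU {ℓ} (Γ : Graph ℓ) : Set (Level.suc ℓ) where
  field
    obU  : Γ₀ Γ → Set ℓ
    morU : ∀ i j → Γ₁ Γ i j → obU i → obU j
open DiagramU public

CoconeU : ∀ {ℓ} {Γ : Graph ℓ} → DiagramU Γ → Set ℓ → Set ℓ
CoconeU {Γ = Γ} D C = Σ[ r ∈ (∀ i → obU D i → C) ]
                      (∀ i j (g : Γ₁ Γ i j) → ∀ x → r j (morU D i j g x) ≡ r i x)

postcompU : ∀ {ℓ} {Γ : Graph ℓ} (D : DiagramU Γ) {C T : Set ℓ}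
          → CoconeU D C → (C → T) → CoconeU D T
postcompU D (r , K) f = (λ i x → f (r i x)) , (λ i j g x → cong f (K i j g x))

isColimitingU : ∀ {ℓ} {Γ : Graph ℓ} (D : DiagramU Γ) {C : Set ℓ} → CoconeU D C → Set (Level.suc ℓ)
isColimitingU {ℓ} D {C} c = ∀ (T : Set ℓ) → isEquiv (postcompU D {C} {T} c)

module _ {ℓ : Level} {A : Set ℓ} where
  open Coslice A

  forgetDiagram : ∀ {Γ} → Diagram Γ → DiagramU Γ
  forgetDiagram F = record { obU = λ i → proj₁ (ob F i)
                           ; morU = λ i j g → proj₁ (mor F i j g) }

  forgetCocone : ∀ {Γ} (F : Diagram Γ) {C : Obj} → Cocone F C
               → CoconeU (forgetDiagram F) (proj₁ C)
  forgetCocone F (r , K) =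
    (λ i → proj₁ (r i)) , (λ i j g → happly (cong proj₁ (K i j g)))

{-# OPTIONS --without-K #-}

-- Fix a type T₀ and compare postcomposition in A/𝓤, taken over all points
-- f : A → T₀ at once, with postcomposition in 𝓤.  Their sources agree, since
-- h ↦ (h ∘ f_C , h , refl) is an equivalence (C₀ → T₀) ≃ Σ f (C ⇒ (T₀ , f)), and
-- their targets are related by the forgetful map Σ f (Cocone F (T₀ , f)) → CoconeU 𝓕(F) T₀,
-- making a commuting square.  The fibre of the forgetful map over a cocone (r , K)
-- is a product over a : A of the types of cocones, inside T₀, under the graph map
-- i ↦ r i (f_i a).  For a tree the realization's universal property makes the
-- constant map from T₀ to graph maps an equivalence, and these types are
-- retracts of its fibres, hence contractible.  So the forgetful map is an
-- equivalence, and colimiting in A/𝓤 (a fibrewise equivalence over f) is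
-- equivalent to colimiting in 𝓤.

module Submission where

open import Defs
open import Level using (Level)
open import Function.Base using (_∘_; id)
open import Function.Bundles using (_⇔_; mk⇔; module Equivalence)
open import Data.Product using (Σ; Σ-syntax; _,_; proj₁; proj₂)
open import Relation.Binary.PropositionalEquality
  using (_≡_; refl; cong; trans; sym; subst; naturality; cong-≡id; module ≡-Reasoning)
open import Relation.Binary.PropositionalEquality.Properties
  using (trans-reflʳ; trans-symˡ; cong-id; cong-∘; trans-cong)

private
  variable
    ℓ : Level
    X Y Z : Set ℓ

sym-sym : {x y : X} (p : x ≡ y) → sym (sym p) ≡ p
sym-sym refl = refl

cong-const : {z : Y} {x y : X} (p : x ≡ y) → cong (λ _ → z) p ≡ refl
cong-const refl = refl

cong-proj₁-cong-, : {B : Set ℓ} {P : B → Set ℓ} {b : B} {u v : P b} (q : u ≡ v) →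
                    cong proj₁ (cong (_,_ {B = P} b) q) ≡ refl
cong-proj₁-cong-, refl = refl

isContr-singleton : (x : X) → isContr (Σ[ y ∈ X ] x ≡ y)
isContr-singleton x = (x , refl) , λ { (_ , refl) → refl }

infix 3 _◁_

record _◁_ (X Y : Set ℓ) : Set ℓ where
  constructor retract
  field
    section            : X → Y
    retraction         : Y → X
    retraction-section : ∀ x → retraction (section x) ≡ x
open _◁_

◁-refl : X ◁ X
◁-refl = retract id id (λ _ → refl)

◁-trans : X ◁ Y → Y ◁ Z → X ◁ Z
◁-trans (retract s r rs) (retract s′ r′ rs′) =
  retract (s′ ∘ s) (r ∘ r′) (λ x → trans (cong r (rs′ (s x))) (rs x))

≡⇒◁ : X ≡ Y → X ◁ Y
≡⇒◁ refl = ◁-refl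

isContr-◁ : X ◁ Y → isContr Y → isContr X
isContr-◁ (retract s r rs) (c , contr) = r c , λ x → trans (cong r (contr (s x))) (rs x)

Σ-◁ : {B : Set ℓ} {P Q : B → Set ℓ} → (∀ b → P b ◁ Q b) → Σ B P ◁ Σ B Q
Σ-◁ ρ = retract (λ (b , p) → b , section (ρ b) p)
                (λ (b , q) → b , retraction (ρ b) q)
                (λ (b , p) → cong (b ,_) (retraction-section (ρ b) p))

trans≡trans-◁ : {z w w′ t : X} (α : z ≡ w) (β : z ≡ w′) (q : w ≡ t) (q′ : w′ ≡ t) →
                (trans α q ≡ trans β q′) ◁ (trans (trans (sym β) α) q ≡ q′)
trans≡trans-◁ α refl q q′ = ◁-refl

sym-◁ : {x y : X} → (x ≡ y) ◁ (y ≡ x)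
sym-◁ = retract sym sym sym-sym

Σ-≡-◁ : {B : Set ℓ} {P : B → Set ℓ} {b b′ : B} {u : P b} {u′ : P b′} →
        (Σ[ e ∈ b ≡ b′ ] subst P e u ≡ u′) ◁ (_≡_ {A = Σ B P} (b , u) (b′ , u′))
Σ-≡-◁ {P = P} = retract pair unpair unpair-pair
  where
  pair : ∀ {b b′} {u : P b} {u′ : P b′} → Σ[ e ∈ b ≡ b′ ] subst P e u ≡ u′ → (b , u) ≡ (b′ , u′)
  pair (refl , refl) = refl
  unpair : ∀ {b b′} {u : P b} {u′ : P b′} → (b , u) ≡ (b′ , u′) → Σ[ e ∈ b ≡ b′ ] subst P e u ≡ u′
  unpair refl = refl , refl
  unpair-pair : ∀ {b b′} {u : P b} {u′ : P b′} (w : Σ[ e ∈ b ≡ b′ ] subst P e u ≡ u′) →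
                unpair (pair w) ≡ w
  unpair-pair (refl , refl) = refl

total : {B : Set ℓ} {P Q : B → Set ℓ} → (∀ b → P b → Q b) → Σ B P → Σ B Q
total φ (b , p) = b , φ b p

module _ {B : Set ℓ} {P Q : B → Set ℓ} (φ : ∀ b → P b → Q b) where

  private
    fiber→fiber-total : ∀ {b q} → fiber (φ b) q → fiber (total φ) (b , q)
    fiber→fiber-total (p , refl) = (_ , p) , refl

    fiber-total→fiber : ∀ {b q} → fiber (total φ) (b , q) → fiber (φ b) q
    fiber-total→fiber ((_ , p) , refl) = p , refl

    fiber-total-fiber : ∀ {b q} (w : fiber (φ b) q) → fiber-total→fiber (fiber→fiber-total w) ≡ w
    fiber-total-fiber (p , refl) = refl

    fiber-fiber-total : ∀ {b q} (w : fiber (total φ) (b , q)) →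
                        fiber→fiber-total (fiber-total→fiber w) ≡ w
    fiber-fiber-total ((_ , p) , refl) = refl

  fiberwise-isEquiv⇔total-isEquiv : (∀ b → isEquiv (φ b)) ⇔ isEquiv (total φ)
  fiberwise-isEquiv⇔total-isEquiv = mk⇔
    (λ e (b , q) → isContr-◁ (retract fiber-total→fiber fiber→fiber-total fiber-fiber-total) (e b q))
    (λ e b q → isContr-◁ (retract fiber→fiber-total fiber-total→fiber fiber-total-fiber) (e (b , q)))

record QInv {X Y : Set ℓ} (f : X → Y) : Set ℓ where
  constructor qinv
  field
    inverse   : Y → X
    inverse-f : ∀ x → inverse (f x) ≡ x
    f-inverse : ∀ y → f (inverse y) ≡ y

isEquiv⇒QInv : {f : X → Y} → isEquiv f → QInv f
isEquiv⇒QInv {f = f} e = qinv (λ y → proj₁ (proj₁ (e y)))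
                              (λ x → cong proj₁ (proj₂ (e (f x)) (x , refl)))
                              (λ y → proj₂ (proj₁ (e y)))

module HalfAdjoint {f : X → Y} (q : QInv f) where
  open QInv q renaming (inverse to g; inverse-f to η; f-inverse to ε)

  -- Adjusting the counit makes (g , η , ε′) a half-adjoint equivalence.
  ε′ : ∀ y → f (g y) ≡ y
  ε′ y = trans (sym (ε (f (g y)))) (trans (cong f (η (g y))) (ε y))

  triangle : ∀ x → cong f (η x) ≡ ε′ (f x)
  triangle x = move (begin
      trans (ε (f (g (f x)))) (cong f (η x))
        ≡⟨ cong (trans (ε (f (g (f x))))) (sym (cong-id (cong f (η x)))) ⟩
      trans (ε (f (g (f x)))) (cong id (cong f (η x))) ≡⟨ sym (naturality ε) ⟩
      trans (cong (f ∘ g) (cong f (η x))) (ε (f x))    ≡⟨ cong (λ p → trans p (ε (f x))) fgfη ⟩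
      trans (cong f (η (g (f x)))) (ε (f x))           ∎)
    where
    open ≡-Reasoning
    move : ∀ {u v w} {p : u ≡ v} {q : v ≡ w} {r : u ≡ w} → trans p q ≡ r → q ≡ trans (sym p) r
    move {p = refl} e = e
    fgfη : cong (f ∘ g) (cong f (η x)) ≡ cong f (η (g (f x)))
    fgfη = begin
      cong (f ∘ g) (cong f (η x)) ≡⟨ sym (cong-∘ (η x)) ⟩
      cong (f ∘ g ∘ f) (η x)      ≡⟨ cong-∘ (η x) ⟩
      cong f (cong (g ∘ f) (η x)) ≡⟨ cong (cong f) (cong-≡id η) ⟩
      cong f (η (g (f x)))        ∎

  fiber-◁-singleton : ∀ y → fiber f y ◁ (Σ[ x ∈ X ] g y ≡ x)
  fiber-◁-singleton y = retract (λ (x , p) → x , trans (sym (cong g p)) (η x))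
                                (λ (x , p) → x , trans (sym (cong f p)) (ε′ y))
                                (retract-section y)
    where
    retract-section : ∀ y (w : fiber f y) →
      (proj₁ w , trans (sym (cong f (trans (sym (cong g (proj₂ w))) (η (proj₁ w))))) (ε′ y)) ≡ w
    retract-section _ (x , refl) = cong (x ,_) (begin
      trans (sym (cong f (η x))) (ε′ (f x))        ≡⟨ cong (trans (sym (cong f (η x)))) (sym (triangle x)) ⟩
      trans (sym (cong f (η x))) (cong f (η x))    ≡⟨ trans-symˡ (cong f (η x)) ⟩
      refl                                         ∎)
      where open ≡-Reasoning

QInv⇒isEquiv : {f : X → Y} → QInv f → isEquiv f
QInv⇒isEquiv q y = isContr-◁ (HalfAdjoint.fiber-◁-singleton q y) (isContr-singleton _)

QInv-∘ : {f : X → Y} {g : Y → Z} → QInv f → QInv g → QInv (g ∘ f)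
QInv-∘ {f = f} {g} (qinv f⁻ ηf εf) (qinv g⁻ ηg εg) =
  qinv (f⁻ ∘ g⁻) (λ x → trans (cong f⁻ (ηg (f x))) (ηf x))
                 (λ z → trans (cong g (εf (g⁻ z))) (εg z))

QInv-inverse : {f : X → Y} (q : QInv f) → QInv (QInv.inverse q)
QInv-inverse {f = f} (qinv g η ε) = qinv f ε η

QInv-resp-∼ : {f g : X → Y} → (∀ x → f x ≡ g x) → QInv f → QInv g
QInv-resp-∼ H (qinv h η ε) =
  qinv h (λ x → trans (cong h (sym (H x))) (η x)) (λ y → trans (sym (H (h y))) (ε y))

isEquiv-square : {X X′ Y Y′ : Set ℓ} {e₁ : X′ → X} {φ : X → Y} {e₂ : Y → Y′} {ψ : X′ → Y′} →
  QInv e₁ → QInv e₂ → (∀ x → e₂ (φ (e₁ x)) ≡ ψ x) → isEquiv φ ⇔ isEquiv ψ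
isEquiv-square {φ = φ} {ψ = ψ} q₁ q₂ square = mk⇔
  (λ e → QInv⇒isEquiv (QInv-resp-∼ square (QInv-∘ q₁ (QInv-∘ (isEquiv⇒QInv e) q₂))))
  (λ e → QInv⇒isEquiv (QInv-resp-∼ square⁻¹
           (QInv-∘ (QInv-inverse q₁) (QInv-∘ (isEquiv⇒QInv e) (QInv-inverse q₂)))))
  where
  open QInv
  square⁻¹ : ∀ y → inverse q₂ (ψ (inverse q₁ y)) ≡ φ y
  square⁻¹ y = trans (cong (inverse q₂) (sym (square (inverse q₁ y))))
                 (trans (inverse-f q₂ _) (cong φ (f-inverse q₁ y)))

module _ {ℓ : Level} (fe : FunExt ℓ) where

  funext-happly : {X : Set ℓ} {B : X → Set ℓ} {f g : (x : X) → B x}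
                  (H : ∀ x → f x ≡ g x) → happly (funext fe H) ≡ H
  funext-happly H = proj₂ (proj₁ (fe H))

  funext-refl : {X : Set ℓ} {B : X → Set ℓ} {f : (x : X) → B x} →
                funext fe (λ x → refl {x = f x}) ≡ refl
  funext-refl = cong proj₁ (proj₂ (fe (λ _ → refl)) (refl , refl))

  happly-◁ : {X : Set ℓ} {B : X → Set ℓ} {f g : (x : X) → B x} →
             (∀ x → f x ≡ g x) ◁ (f ≡ g)
  happly-◁ = retract (funext fe) happly funext-happly

  Π-◁ : {B : Set ℓ} {P Q : B → Set ℓ} → (∀ b → P b ◁ Q b) → ((b : B) → P b) ◁ ((b : B) → Q b)
  Π-◁ ρ = retract (λ u b → section (ρ b) (u b))
                  (λ v b → retraction (ρ b) (v b))
                  (λ u → funext fe (λ b → retraction-section (ρ b) (u b)))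

  Π-isContr : {B : Set ℓ} {P : B → Set ℓ} → (∀ b → isContr (P b)) → isContr ((b : B) → P b)
  Π-isContr c = (λ b → proj₁ (c b)) , λ u → funext fe (λ b → proj₂ (c b) (u b))

  Σ-happly-◁ : {X : Set ℓ} {B : X → Set ℓ} {f g : (x : X) → B x}
               (R : (∀ x → f x ≡ g x) → Set ℓ) → Σ _ R ◁ Σ (f ≡ g) (R ∘ happly)
  Σ-happly-◁ R = retract (λ (H , r) → funext fe H , subst R (sym (funext-happly H)) r)
                         (λ (e , r) → happly e , r)
                         (λ (H , r) → transport-back (funext-happly H) r)
    where
    transport-back : ∀ {H H′} (α : H ≡ H′) (r : R H′) →
                     _≡_ {A = Σ _ R} (H , subst R (sym α) r) (H′ , r)
    transport-back refl r = refl

  const-QInv : {K T : Set ℓ} → isContr K → QInv (λ (t : T) (_ : K) → t)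
  const-QInv (k , contr) =
    qinv (λ u → u k) (λ _ → refl) (λ u → funext fe (λ k′ → cong u (contr k′)))

  module GraphMaps (Γ : Graph ℓ) (T : Set ℓ) where

    EdgePaths : (Γ₀ Γ → T) → Set ℓ
    EdgePaths p = ∀ i j → Γ₁ Γ i j → p i ≡ p j

    -- The recursion data of the realization of Γ into T.
    GraphMap : Set ℓ
    GraphMap = Σ (Γ₀ Γ → T) EdgePaths

    infix 4 _≈_
    _≈_ : GraphMap → GraphMap → Set ℓ
    (p , E) ≈ (p′ , E′) =
      Σ[ H ∈ (∀ i → p i ≡ p′ i) ] (∀ i j g → trans (E i j g) (H j) ≡ trans (H i) (E′ i j g))

    ≈-◁-≡ : {m m′ : GraphMap} → m ≈ m′ ◁ m ≡ m′
    ≈-◁-≡ {p , E} {p′ , E′} =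
      ◁-trans (Σ-happly-◁ _) (◁-trans (Σ-◁ λ e → coherence-◁ e E′) Σ-≡-◁)
      where
      coherence-◁ : ∀ {p′} (e : p ≡ p′) (E′ : EdgePaths p′) →
        (∀ i j g → trans (E i j g) (happly e j) ≡ trans (happly e i) (E′ i j g))
          ◁ (subst EdgePaths e E ≡ E′)
      coherence-◁ refl E′ =
        ◁-trans (Π-◁ λ i → Π-◁ λ j → Π-◁ λ g → ≡⇒◁ (cong (_≡ E′ i j g) (trans-reflʳ (E i j g))))
       (◁-trans (Π-◁ λ i → Π-◁ λ j → happly-◁)
       (◁-trans (Π-◁ λ i → happly-◁) happly-◁))

    PathCocone : GraphMap → Set ℓ
    PathCocone (p , E) =
      Σ[ t ∈ T ] Σ[ rp ∈ (∀ i → p i ≡ t) ] (∀ i j g → trans (E i j g) (rp j) ≡ rp i)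

    module _ (R : Realization Γ) where

      restrict : (Carrier R → T) → GraphMap
      restrict u = (λ i → u (pt R i)) , (λ i j g → cong u (edge R i j g))

      const : T → GraphMap
      const t = restrict (λ _ → t)

      const-isEquiv : isTree Γ R → isEquiv const
      const-isEquiv tree = QInv⇒isEquiv (QInv-∘ (const-QInv tree) (isEquiv⇒QInv (univ R T)))

      PathCocone-isContr : isTree Γ R → ∀ m → isContr (PathCocone m)
      PathCocone-isContr tree m@(p , E) = isContr-◁
        (◁-trans (Σ-◁ λ t → Σ-◁ λ rp → Π-◁ λ i → Π-◁ λ j → Π-◁ λ g →
                    ≡⇒◁ (cong (trans (E i j g) (rp j) ≡_) (sym (drop-const t (rp i) (edge R i j g)))))
        (◁-trans (Σ-◁ λ t → ≈-◁-≡) (Σ-◁ λ t → sym-◁)))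
        (const-isEquiv tree m)
        where
        drop-const : ∀ t {x y} {z : Carrier R} (q : x ≡ t) (e : y ≡ z) →
                     trans q (cong (λ _ → t) e) ≡ q
        drop-const t q e = trans (cong (trans q) (cong-const e)) (trans-reflʳ q)

  module CosliceColimits (A : Set ℓ) where
    open Coslice A

    module _ {S T : Obj} where

      Coherent : (u v : S ⇒ T) → (∀ z → proj₁ u z ≡ proj₁ v z) → Set ℓ
      Coherent u v H = ∀ a → proj₂ u a ≡ trans (H (proj₂ S a)) (proj₂ v a)

      private
        path-over : {u v : S ⇒ T} (e : proj₁ u ≡ proj₁ v) → Coherent u v (happly e) → u ≡ v
        path-over {h , _} refl d = cong (h ,_) (funext fe d)

        path-over-proj₁ : {u v : S ⇒ T} (e : proj₁ u ≡ proj₁ v) (d : Coherent u v (happly e)) →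
                          cong proj₁ (path-over e d) ≡ e
        path-over-proj₁ refl d = cong-proj₁-cong-, (funext fe d)

        -- Homotopy induction: H is replaced by a path in the fibre of happly over it.
        path-via : {u v : S ⇒ T} {H : ∀ z → proj₁ u z ≡ proj₁ v z} →
                   fiber happly H → Coherent u v H → u ≡ v
        path-via (e , refl) = path-over e

      ⇒-path : {u v : S ⇒ T} (H : ∀ z → proj₁ u z ≡ proj₁ v z) → Coherent u v H → u ≡ v
      ⇒-path H = path-via (proj₁ (fe H))

      ⇒-path-coherence : {u v : S ⇒ T} (p : u ≡ v) → Coherent u v (happly (cong proj₁ p))
      ⇒-path-coherence refl a = refl

      ⇒-path-underlying : {u v : S ⇒ T} (H : ∀ z → proj₁ u z ≡ proj₁ v z) (d : Coherent u v H) →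
                          happly (cong proj₁ (⇒-path H d)) ≡ H
      ⇒-path-underlying H = underlying (proj₁ (fe H))
        where
        underlying : ∀ {u v H} (w : fiber happly H) (d : Coherent u v H) →
                     happly (cong proj₁ (path-via w d)) ≡ H
        underlying (e , refl) d = cong happly (path-over-proj₁ e d)

      ⇒-path-η : {u v : S ⇒ T} (p : u ≡ v) → ⇒-path (happly (cong proj₁ p)) (⇒-path-coherence p) ≡ p
      ⇒-path-η {h , _} refl =
        trans (cong (λ w → path-via w (λ _ → refl)) (proj₂ (fe (λ _ → refl)) (refl , refl)))
              (cong (cong (h ,_)) funext-refl)

    happly-cong-∘A : {R S T : Obj} (h : S ⇒ T) {u v : R ⇒ S} (K : u ≡ v) (x : proj₁ R) →
                     happly (cong proj₁ (cong (h ∘A_) K)) x ≡ cong (proj₁ h) (happly (cong proj₁ K) x)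
    happly-cong-∘A h refl x = refl

    module _ {Γ : Graph ℓ} (F : Diagram Γ) where

      forgetCocone-postcomp : {C T : Obj} (c : Cocone F C) (h : C ⇒ T) →
        forgetCocone F (postcomp fe F c h) ≡ postcompU (forgetDiagram F) (forgetCocone F c) (proj₁ h)
      forgetCocone-postcomp (r , K) h =
        cong ((λ i x → proj₁ h (proj₁ (r i) x)) ,_)
             (funext fe λ i → funext fe λ j → funext fe λ g → funext fe λ x → pointwise i j g x)
        where
        open ≡-Reasoning
        pointwise : ∀ i j g x →
          happly (cong proj₁ (proj₂ (postcomp fe F (r , K) h) i j g)) x
            ≡ cong (proj₁ h) (happly (cong proj₁ (K i j g)) x)
        pointwise i j g x = begin
          happly (cong proj₁ (trans (assoc fe h (r j) (mor F i j g)) (cong (h ∘A_) (K i j g)))) x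
            ≡⟨ cong (λ q → happly q x) (sym (trans-cong {f = proj₁} (assoc fe h (r j) (mor F i j g)))) ⟩
          happly (trans (cong proj₁ (assoc fe h (r j) (mor F i j g)))
                        (cong proj₁ (cong (h ∘A_) (K i j g)))) x
            ≡⟨ cong (λ q → happly (trans q (cong proj₁ (cong (h ∘A_) (K i j g)))) x)
                    (cong-proj₁-cong-, _) ⟩
          happly (cong proj₁ (cong (h ∘A_) (K i j g))) x
            ≡⟨ happly-cong-∘A h (K i j g) x ⟩
          cong (proj₁ h) (happly (cong proj₁ (K i j g)) x) ∎

      module _ (T₀ : Set ℓ) where
        open GraphMaps Γ T₀

        forgetCocone-Σ : Σ[ f ∈ (A → T₀) ] Cocone F (T₀ , f) → CoconeU (forgetDiagram F) T₀
        forgetCocone-Σ (_ , c) = forgetCocone F c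

        -- The fibre of forgetCocone-Σ over (r , K) is the product over a : A of these types.
        Extension : CoconeU (forgetDiagram F) T₀ → A → Set ℓ
        Extension (r , K) a =
          Σ[ t ∈ T₀ ] Σ[ rp ∈ (∀ i → r i (proj₂ (ob F i) a) ≡ t) ]
            (∀ i j g → trans (cong (r j) (proj₂ (mor F i j g) a)) (rp j)
                         ≡ trans (K i j g (proj₂ (ob F i) a)) (rp i))

        Extension-◁-PathCocone : ∀ rK a → Extension rK a ◁ PathCocone
          ((λ i → proj₁ rK i (proj₂ (ob F i) a)) ,
           (λ i j g → trans (sym (proj₂ rK i j g (proj₂ (ob F i) a)))
                            (cong (proj₁ rK j) (proj₂ (mor F i j g) a))))
        Extension-◁-PathCocone (r , K) a = Σ-◁ λ t → Σ-◁ λ rp → Π-◁ λ i → Π-◁ λ j → Π-◁ λ g →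
          trans≡trans-◁ (cong (r j) (proj₂ (mor F i j g) a)) (K i j g (proj₂ (ob F i) a)) (rp j) (rp i)

        extend : (rK : CoconeU (forgetDiagram F) T₀) → (∀ a → Extension rK a) →
                 Σ[ f ∈ (A → T₀) ] Cocone F (T₀ , f)
        extend (r , K) ξ =
          (λ a → proj₁ (ξ a)) ,
          (λ i → r i , λ a → proj₁ (proj₂ (ξ a)) i) ,
          (λ i j g → ⇒-path (K i j g) (λ a → proj₂ (proj₂ (ξ a)) i j g))

        restrict-extension : (w : Σ[ f ∈ (A → T₀) ] Cocone F (T₀ , f)) →
                             ∀ a → Extension (forgetCocone-Σ w) a
        restrict-extension (f , r , K) a =
          f a , (λ i → proj₂ (r i) a) , (λ i j g → ⇒-path-coherence (K i j g) a)

        forgetCocone-Σ-extend : ∀ rK ξ → forgetCocone-Σ (extend rK ξ) ≡ rK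
        forgetCocone-Σ-extend (r , K) ξ =
          cong (r ,_) (funext fe λ i → funext fe λ j → funext fe λ g →
            ⇒-path-underlying (K i j g) (λ a → proj₂ (proj₂ (ξ a)) i j g))

        extend-restrict-extension : ∀ w → extend (forgetCocone-Σ w) (restrict-extension w) ≡ w
        extend-restrict-extension (f , r , K) =
          cong (λ K′ → f , r , K′) (funext fe λ i → funext fe λ j → funext fe λ g → ⇒-path-η (K i j g))

        forgetCocone-Σ-QInv : (R : Realization Γ) → isTree Γ R → QInv forgetCocone-Σ
        forgetCocone-Σ-QInv R tree = qinv
          (λ rK → extend rK (proj₁ (extensions-isContr rK)))
          (λ w → trans (cong (extend (forgetCocone-Σ w))
                             (proj₂ (extensions-isContr (forgetCocone-Σ w)) (restrict-extension w)))
                       (extend-restrict-extension w))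
          (λ rK → forgetCocone-Σ-extend rK _)
          where
          extensions-isContr : ∀ rK → isContr (∀ a → Extension rK a)
          extensions-isContr rK = Π-isContr λ a →
            isContr-◁ (Extension-◁-PathCocone rK a) (PathCocone-isContr R tree _)

    induced⇒ : {C : Obj} {T₀ : Set ℓ} → (proj₁ C → T₀) → Σ[ f ∈ (A → T₀) ] C ⇒ (T₀ , f)
    induced⇒ {C} h = (λ a → h (proj₂ C a)) , h , (λ _ → refl)

    induced⇒-QInv : {C : Obj} {T₀ : Set ℓ} → QInv (induced⇒ {C} {T₀})
    induced⇒-QInv {C} = qinv (λ (_ , h , _) → h) (λ _ → refl)
      (λ (f , h , hp) → trans (along h (funext fe hp)) (cong (λ q → f , h , q) (funext-happly hp)))
      where
      along : ∀ {T₀} (h : proj₁ C → T₀) {f} (e : (λ a → h (proj₂ C a)) ≡ f) →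
              induced⇒ h ≡ (f , h , happly e)
      along h refl = refl

    postcomp-total⇔postcompU : {Γ : Graph ℓ} (R : Realization Γ) → isTree Γ R →
      (F : Diagram Γ) {C : Obj} (c : Cocone F C) (T₀ : Set ℓ) →
      isEquiv (total (λ f → postcomp fe F {C} {T₀ , f} c))
        ⇔ isEquiv (postcompU (forgetDiagram F) {T = T₀} (forgetCocone F c))
    postcomp-total⇔postcompU R tree F c T₀ =
      isEquiv-square induced⇒-QInv (forgetCocone-Σ-QInv F T₀ R tree)
                     (λ h → forgetCocone-postcomp F c (h , λ _ → refl))

mainTheorem2 : ∀ {ℓ : Level} (fe : FunExt ℓ) (A : Set ℓ) (Γ : Graph ℓ)
                 (R : Realization Γ) → isTree Γ R →
                 (F : Coslice.Diagram A Γ) (C : Coslice.Obj A)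
                 (c : Coslice.Cocone A F C) →
                 Coslice.isColimiting A fe F c
                   ⇔ isColimitingU (forgetDiagram F) (forgetCocone F c)
mainTheorem2 fe A Γ R tree F C c = mk⇔
  (λ colim T₀ → to (postcomp-total⇔postcompU R tree F c T₀)
                   (to (fiberwise-isEquiv⇔total-isEquiv _) (λ f → colim (T₀ , f))))
  (λ colimU (T₀ , f) → from (fiberwise-isEquiv⇔total-isEquiv _)
                             (from (postcomp-total⇔postcompU R tree F c T₀) (colimU T₀)) f)
  where
  open CosliceColimits fe A
  open Equivalence
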